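{- Let $G$ be a group with identity $\mathbf{1}$, $S$ an inverse-closed subset of $G$, and $X=\mathrm{Cay}(G;S)$. If the only colour-preserving automorphism of $X$ that fixes the vertex $\mathbf{1}$ is the identity (equivalently, every colour-preserving automorphism of $X$ is a left translation $x\mapsto gx$), then $X$ is strongly CCA.
   Context: $\mathrm{Cay}(G;S)$ has vertex set $G$ and edges $\{g,gs\}$ for $g\in G$, $s\in S$; the edge $\{g,gs\}$ is coloured $\{s,s^{ -1}\}$. A graph automorphism is colour-preserving if it maps each edge to an edge of the same colour, and colour-permuting if any two edges of the same colour are mapped to edges of a common colour. Left translations are colour-preserving. A map $G\to G$ is affine if it is of the form $x\mapsto\alpha(gx)$ with $\alpha$ a group automorphism of $G$ and $g\in G$; $X$ is strongly CCA if every colour-permuting automorphism of $X$ is affine. -}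

module Defs where

open import Level using (Level; _⊔_; suc)
open import Data.Product using (Σ; ∃; _×_; _,_)
open import Data.Sum using (_⊎_)
open import Relation.Unary using (Pred; _∈_)
open import Relation.Binary.PropositionalEquality using (_≡_)
open import Function.Definitions using (Bijective)
open import Algebra.Structures using (IsGroup)

record PGroup (a : Level) : Set (suc a) where
  infixl 7 _∙_
  field
    Carrier : Set a
    _∙_     : Carrier → Carrier → Carrier
    ε       : Carrier
    _⁻¹     : Carrier → Carrier
    isGroup : IsGroup _≡_ _∙_ ε _⁻¹

module _ {a : Level} (G : PGroup a) where
  open PGroup G

  InverseClosed : ∀ {ℓ} → Pred Carrier ℓ → Set (a ⊔ ℓ)
  InverseClosed S = ∀ s → s ∈ S → (s ⁻¹) ∈ S

  module _ {ℓ : Level} (S : Pred Carrier ℓ) where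

    Adj : Carrier → Carrier → Set (a ⊔ ℓ)
    Adj x y = Σ Carrier λ s → s ∈ S × y ≡ x ∙ s

    -- The edge {x, y} (with y = x s) has colour {s, s⁻¹}; s = x⁻¹ y.
    -- We represent the colour of the ordered pair (x , y) by x⁻¹ y;
    -- two representatives c, d denote the same colour {c,c⁻¹} = {d,d⁻¹}
    -- iff c ≡ d or c ≡ d⁻¹.
    colour : Carrier → Carrier → Carrier
    colour x y = (x ⁻¹) ∙ y

    SameColour : Carrier → Carrier → Set a
    SameColour c d = c ≡ d ⊎ c ≡ d ⁻¹

    IsGraphAut : (Carrier → Carrier) → Set (a ⊔ ℓ)
    IsGraphAut φ = Bijective _≡_ _≡_ φ
                 × (∀ x y → (Adj x y → Adj (φ x) (φ y)) × (Adj (φ x) (φ y) → Adj x y))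

    ColourPreserving : (Carrier → Carrier) → Set (a ⊔ ℓ)
    ColourPreserving φ = ∀ x y → Adj x y → SameColour (colour (φ x) (φ y)) (colour x y)

    ColourPermuting : (Carrier → Carrier) → Set (a ⊔ ℓ)
    ColourPermuting φ = ∀ x y u v → Adj x y → Adj u v →
      SameColour (colour x y) (colour u v) →
      SameColour (colour (φ x) (φ y)) (colour (φ u) (φ v))

  IsGroupAut : (Carrier → Carrier) → Set a
  IsGroupAut α = Bijective _≡_ _≡_ α × (∀ x y → α (x ∙ y) ≡ α x ∙ α y)

  IsAffine : (Carrier → Carrier) → Set a
  IsAffine φ = Σ (Carrier → Carrier) λ α → Σ Carrier λ g →
    IsGroupAut α × (∀ x → φ x ≡ α (g ∙ x))

  module _ {ℓ : Level} (S : Pred Carrier ℓ) where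
    StronglyCCA : Set (a ⊔ ℓ)
    StronglyCCA = ∀ (φ : Carrier → Carrier) → IsGraphAut S φ → ColourPermuting S φ → IsAffine φ

module Submission where

-- A colour-permuting automorphism φ conjugates each left translation x ↦ g x to a
-- colour-preserving automorphism φ ∘ (g ∙_) ∘ φ⁻¹, which by rigidity is again a left
-- translation, namely by τ g = φ (g φ⁻¹(1)). So φ (g y) = τ g · φ y for all g, y, and
-- then α x = φ(1)⁻¹ φ x is a group automorphism with φ x = α (d x) whenever α d = φ(1).

open import Defs
open import Level using (Level; _⊔_)
open import Relation.Unary using (Pred)
open import Relation.Binary.PropositionalEquality
open import Data.Product using (_,_; proj₁; proj₂)
open import Data.Sum using (inj₁)
open import Function.Base using (_∘_)
open import Function.Bundles using (Bijection; Inverse; _↔_; mk⤖)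
open import Function.Definitions using (Bijective)
open import Function.Properties.Bijection using (⤖⇒↔)
open import Function.Properties.Inverse using (↔-sym; ↔⇒⤖)
import Function.Construct.Composition as Composition
open import Algebra.Bundles using (Group)
open import Algebra.Structures using (IsGroup)
import Algebra.Properties.Group as GroupProperties

module _ {a : Level} (G : PGroup a) where
  open PGroup G
  open IsGroup isGroup using (assoc; identityʳ; inverseˡ)
  open ≡-Reasoning

  private
    group : Group a a
    group = record { isGroup = isGroup }

  open GroupProperties group
    using (\\-leftDividesˡ; \\-leftDividesʳ; //-rightDividesʳ; ⁻¹-anti-homo-∙; ∙-cancelˡ)

  translate-bijective : ∀ g → Bijective _≡_ _≡_ (g ∙_)
  translate-bijective g =
    (λ {x} {y} → ∙-cancelˡ g x y) , λ y → g ⁻¹ ∙ y , λ { refl → \\-leftDividesˡ g y }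

  equivariant⇒affine : ∀ {φ} → Bijective _≡_ _≡_ φ → (τ : Carrier → Carrier) →
                       (∀ x y → φ (x ∙ y) ≡ τ x ∙ φ y) → IsAffine G φ
  equivariant⇒affine {φ} φ-bij τ equivariant = α , d , (α-bij , α-hom) , φ≡α[d∙_]
    where
      p : Carrier
      p = φ ε

      α : Carrier → Carrier
      α x = p ⁻¹ ∙ φ x

      α-bij : Bijective _≡_ _≡_ α
      α-bij = Composition.bijective _≡_ _≡_ _≡_ φ-bij (translate-bijective (p ⁻¹))

      τ≡φ∙p⁻¹ : ∀ x → τ x ≡ φ x ∙ p ⁻¹
      τ≡φ∙p⁻¹ x = begin
        τ x                  ≡⟨ //-rightDividesʳ p (τ x) ⟨
        (τ x ∙ p) ∙ p ⁻¹     ≡⟨ cong (_∙ p ⁻¹) (equivariant x ε) ⟨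
        φ (x ∙ ε) ∙ p ⁻¹     ≡⟨ cong (λ t → φ t ∙ p ⁻¹) (identityʳ x) ⟩
        φ x ∙ p ⁻¹           ∎

      α-hom : ∀ x y → α (x ∙ y) ≡ α x ∙ α y
      α-hom x y = begin
        p ⁻¹ ∙ φ (x ∙ y)              ≡⟨ cong (p ⁻¹ ∙_) (equivariant x y) ⟩
        p ⁻¹ ∙ (τ x ∙ φ y)            ≡⟨ cong (λ t → p ⁻¹ ∙ (t ∙ φ y)) (τ≡φ∙p⁻¹ x) ⟩
        p ⁻¹ ∙ ((φ x ∙ p ⁻¹) ∙ φ y)   ≡⟨ cong (p ⁻¹ ∙_) (assoc (φ x) (p ⁻¹) (φ y)) ⟩
        p ⁻¹ ∙ (φ x ∙ (p ⁻¹ ∙ φ y))   ≡⟨ assoc (p ⁻¹) (φ x) (α y) ⟨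
        α x ∙ α y                     ∎

      d : Carrier
      d = proj₁ (proj₂ α-bij p)

      φ≡α[d∙_] : ∀ x → φ x ≡ α (d ∙ x)
      φ≡α[d∙_] x = begin
        φ x              ≡⟨ \\-leftDividesˡ p (φ x) ⟨
        p ∙ α x          ≡⟨ cong (_∙ α x) (proj₂ (proj₂ α-bij p) refl) ⟨
        α d ∙ α x        ≡⟨ α-hom d x ⟨
        α (d ∙ x)        ∎

  module _ {ℓ : Level} (S : Pred Carrier ℓ) where

    ColourRigid : Set (a ⊔ ℓ)
    ColourRigid = ∀ ψ → IsGraphAut G S ψ → ColourPreserving G S ψ → ψ ε ≡ ε → ∀ x → ψ x ≡ x

    translate-adj : ∀ g {x y} → Adj G S x y → Adj G S (g ∙ x) (g ∙ y)
    translate-adj g {x} (s , s∈S , refl) = s , s∈S , sym (assoc g x s)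

    translate-isGraphAut : ∀ g → IsGraphAut G S (g ∙_)
    translate-isGraphAut g = translate-bijective g , λ x y →
      translate-adj g ,
      λ adj → subst₂ (Adj G S) (\\-leftDividesʳ g x) (\\-leftDividesʳ g y) (translate-adj (g ⁻¹) adj)

    ∘-isGraphAut : ∀ {f h} → IsGraphAut G S f → IsGraphAut G S h → IsGraphAut G S (f ∘ h)
    ∘-isGraphAut {f} {h} (f-bij , f-adj) (h-bij , h-adj) =
      Composition.bijective _≡_ _≡_ _≡_ h-bij f-bij , λ x y →
      proj₁ (f-adj (h x) (h y)) ∘ proj₁ (h-adj x y) ,
      proj₂ (h-adj x y) ∘ proj₂ (f-adj (h x) (h y))

    colour-translate : ∀ g u v → colour G S (g ∙ u) (g ∙ v) ≡ colour G S u v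
    colour-translate g u v = begin
      (g ∙ u) ⁻¹ ∙ (g ∙ v)      ≡⟨ cong (_∙ (g ∙ v)) (⁻¹-anti-homo-∙ g u) ⟩
      (u ⁻¹ ∙ g ⁻¹) ∙ (g ∙ v)   ≡⟨ assoc (u ⁻¹) (g ⁻¹) (g ∙ v) ⟩
      u ⁻¹ ∙ (g ⁻¹ ∙ (g ∙ v))   ≡⟨ cong (u ⁻¹ ∙_) (\\-leftDividesʳ g v) ⟩
      u ⁻¹ ∙ v                  ∎

    rigid⇒translation : ColourRigid → ∀ {θ} → IsGraphAut G S θ → ColourPreserving G S θ →
                        ∀ z → θ z ≡ θ ε ∙ z
    rigid⇒translation rigid {θ} θ-aut θ-cp z = begin
      θ z                         ≡⟨ \\-leftDividesˡ (θ ε) (θ z) ⟨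
      θ ε ∙ ((θ ε) ⁻¹ ∙ θ z)      ≡⟨ cong (θ ε ∙_) (rigid θ′ θ′-aut θ′-cp (inverseˡ (θ ε)) z) ⟩
      θ ε ∙ z                     ∎
      where
        θ′ : Carrier → Carrier
        θ′ x = (θ ε) ⁻¹ ∙ θ x

        θ′-aut : IsGraphAut G S θ′
        θ′-aut = ∘-isGraphAut (translate-isGraphAut ((θ ε) ⁻¹)) θ-aut

        θ′-cp : ColourPreserving G S θ′
        θ′-cp x y adj = subst (λ c → SameColour G S c (colour G S x y))
                              (sym (colour-translate ((θ ε) ⁻¹) (θ x) (θ y))) (θ-cp x y adj)

    module Conjugation {φ : Carrier → Carrier} (φ-aut : IsGraphAut G S φ) where

      φ↔ : Carrier ↔ Carrier
      φ↔ = ⤖⇒↔ (mk⤖ (proj₁ φ-aut))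

      open Inverse φ↔ public using (from; strictlyInverseˡ; strictlyInverseʳ)

      from-isGraphAut : IsGraphAut G S from
      from-isGraphAut = Bijection.bijective (↔⇒⤖ (↔-sym φ↔)) , λ x y →
        (λ adj → proj₂ (proj₂ φ-aut (from x) (from y))
                   (subst₂ (Adj G S) (sym (strictlyInverseˡ x)) (sym (strictlyInverseˡ y)) adj)) ,
        (λ adj → subst₂ (Adj G S) (strictlyInverseˡ x) (strictlyInverseˡ y)
                   (proj₁ (proj₂ φ-aut (from x) (from y)) adj))

      conjugate-isGraphAut : ∀ {ψ} → IsGraphAut G S ψ → IsGraphAut G S (φ ∘ ψ ∘ from)
      conjugate-isGraphAut ψ-aut = ∘-isGraphAut φ-aut (∘-isGraphAut ψ-aut from-isGraphAut)

      conjugate-colourPreserving : ColourPermuting G S φ → ∀ {ψ} → IsGraphAut G S ψ →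
                                   ColourPreserving G S ψ → ColourPreserving G S (φ ∘ ψ ∘ from)
      conjugate-colourPreserving φ-cp {ψ} (_ , ψ-adj) ψ-cp z w adj =
        subst (SameColour G S _) (cong₂ (colour G S) (strictlyInverseˡ z) (strictlyInverseˡ w))
          (φ-cp (ψ (from z)) (ψ (from w)) (from z) (from w)
                (proj₁ (ψ-adj (from z) (from w)) adj′) adj′ (ψ-cp (from z) (from w) adj′))
        where
          adj′ : Adj G S (from z) (from w)
          adj′ = proj₁ (proj₂ from-isGraphAut z w) adj

      colourPermuting⇒equivariant : ColourRigid → ColourPermuting G S φ →
                                    ∀ g y → φ (g ∙ y) ≡ φ (g ∙ from ε) ∙ φ y
      colourPermuting⇒equivariant rigid φ-cp g y = begin
        φ (g ∙ y)                   ≡⟨ cong (λ t → φ (g ∙ t)) (strictlyInverseʳ y) ⟨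
        φ (g ∙ from (φ y))          ≡⟨ rigid⇒translation rigid
                                         (conjugate-isGraphAut (translate-isGraphAut g))
                                         (conjugate-colourPreserving φ-cp (translate-isGraphAut g)
                                           (λ x y _ → inj₁ (colour-translate g x y)))
                                         (φ y) ⟩
        φ (g ∙ from ε) ∙ φ y        ∎

corollary4p7 : ∀ {a ℓ : Level} (G : PGroup a) (S : Pred (PGroup.Carrier G) ℓ) →
    InverseClosed G S →
    (∀ (φ : PGroup.Carrier G → PGroup.Carrier G) → IsGraphAut G S φ → ColourPreserving G S φ →
    φ (PGroup.ε G) ≡ PGroup.ε G → ∀ x → φ x ≡ x) →
    StronglyCCA G S
corollary4p7 G S _ rigid φ φ-aut φ-cp =
  equivariant⇒affine G (proj₁ φ-aut) _ (colourPermuting⇒equivariant rigid φ-cp)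
  where open Conjugation G S φ-aut
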